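{- Let $\mathcal D_2'$ be the set of discriminant forms $D$ which are orthogonal sums of Jordan components of type $2_{I\!I}^{\pm n}$, $2_t^{\pm n}$ and $4_s^{\pm m}$ and which contain no isotropic subgroup isomorphic to $(\mathbb Z/2\mathbb Z)^2$. Then $\mathcal D_2'$ consists (up to isomorphism) exactly of: $\{0\}$, $2_{I\!I}^{\pm2}$, $2_{I\!I}^{ -4}$; $2_t^{\pm n}$ with $n\le3$; $2_t^{\epsilon4}$ with $\epsilon e(t/8)\ne1$; $2_t^{\epsilon5}$ with $\epsilon\left(\frac{t}{2}\right)=-1$; $4_s^{\pm1}$, $2_{I\!I}^{\pm2}4_s^{\pm1}$; $2_t^{\pm n}4_s^{\pm1}$ with $n\le3$; $4_s^{\pm2}$, $2_t^{\pm1}4_s^{\pm2}$.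
   Context: A discriminant form is a finite abelian group $D$ with a quadratic form $\operatorname{q}:D\to\mathbb Q/\mathbb Z$ whose bilinear form is non-degenerate; a subgroup is isotropic if $\operatorname{q}$ vanishes on it. 2-adic Jordan components in Conway–Sloane notation: $q_{I\!I}^{\pm2n}$ is an even component isomorphic to $(\mathbb Z/q\mathbb Z)^{2n}$ of level $q$; $q_t^{\pm n}$ is an odd component isomorphic to $(\mathbb Z/q\mathbb Z)^n$ of level $2q$, with oddity $t\in\mathbb Z/8\mathbb Z$. $\left(\frac{t}{2}\right)$ is the Kronecker symbol and $e(z)=e^{2\pi iz}$. -}

module Defs where

open import Data.Nat using (ℕ; zero; suc; _+_; _*_; _≤_)
open import Data.Nat.DivMod using (_mod_)
open import Data.Fin using (Fin; toℕ) renaming (zero to fz)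
open import Data.Product using (Σ; _×_; _,_)
open import Data.Unit using (⊤; tt)
open import Data.List using (List; []; _∷_; map; length; foldr; _++_)
open import Data.Nat.ListAction using (sum)
open import Data.Sign using (Sign) renaming (_*_ to _*ₛ_)
open import Data.Integer using (ℤ; _◃_; -1ℤ; 0ℤ; 1ℤ) renaming (_*_ to _*ℤ_)
open import Relation.Binary.PropositionalEquality using (_≡_; _≢_)

-- Building blocks of 2-adic discriminant forms of exponent ≤ 4.
-- All values of q lie in (1/8)ℤ/ℤ, so we record q(x) = k/8 by k ∈ ℤ/8ℤ
-- (represented as Fin 8).

data Odd8 : Set where
  o1 o3 o5 o7 : Odd8

oddℕ : Odd8 → ℕ
oddℕ o1 = 1
oddℕ o3 = 3
oddℕ o5 = 5
oddℕ o7 = 7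

kronOdd : Odd8 → Sign
kronOdd o1 = Sign.+
kronOdd o3 = Sign.-
kronOdd o5 = Sign.-
kronOdd o7 = Sign.+

kron2 : Fin 8 → ℤ
kron2 t with toℕ t
... | 1 = 1ℤ
... | 3 = -1ℤ
... | 5 = -1ℤ
... | 7 = 1ℤ
... | _ = 0ℤ

-- even planes: hypP = 2_II^{+2} (q(x,y) = xy/2),
--              ellP = 2_II^{-2} (q(x,y) = (x²+xy+y²)/2)
data Plane : Set where
  hypP ellP : Plane

planeSign : Plane → Sign
planeSign hypP = Sign.+
planeSign ellP = Sign.-

-- atoms: an even plane, a 1-dim odd level-4 form 2_a^{(a/2)1} on ℤ/2
-- (q(x) = a x²/4), or a 1-dim odd level-8 form 4_a^{(a/2)1} on ℤ/4
-- (q(x) = a x²/8)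
data Atom : Set where
  plane : Plane → Atom
  odd2  : Odd8 → Atom
  odd4  : Odd8 → Atom

AElem : Atom → Set
AElem (plane _) = Fin 2 × Fin 2
AElem (odd2 _) = Fin 2
AElem (odd4 _) = Fin 4

addMod2 : Fin 2 → Fin 2 → Fin 2
addMod2 x y = (toℕ x + toℕ y) mod 2

addMod4 : Fin 4 → Fin 4 → Fin 4
addMod4 x y = (toℕ x + toℕ y) mod 4

aAdd : (a : Atom) → AElem a → AElem a → AElem a
aAdd (plane _) (x , y) (x' , y') = addMod2 x x' , addMod2 y y'
aAdd (odd2 _) x y = addMod2 x y
aAdd (odd4 _) x y = addMod4 x y

aZero : (a : Atom) → AElem a
aZero (plane _) = fz , fz
aZero (odd2 _) = fz
aZero (odd4 _) = fz

-- 8 · q(x) as a natural number (to be read mod 8)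
aQ : (a : Atom) → AElem a → ℕ
aQ (plane hypP) (x , y) = 4 * (toℕ x * toℕ y)
aQ (plane ellP) (x , y) = 4 * (toℕ x * toℕ x + toℕ x * toℕ y + toℕ y * toℕ y)
aQ (odd2 a) x = 2 * (oddℕ a * (toℕ x * toℕ x))
aQ (odd4 a) x = oddℕ a * (toℕ x * toℕ x)

Elem : List Atom → Set
Elem [] = ⊤
Elem (a ∷ as) = AElem a × Elem as

add : (D : List Atom) → Elem D → Elem D → Elem D
add [] _ _ = tt
add (a ∷ as) (x , xs) (y , ys) = aAdd a x y , add as xs ys

zeroE : (D : List Atom) → Elem D
zeroE [] = tt
zeroE (a ∷ as) = aZero a , zeroE as

qnum : (D : List Atom) → Elem D → ℕ
qnum [] _ = 0
qnum (a ∷ as) (x , xs) = aQ a x + qnum as xs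

Q : (D : List Atom) → Elem D → Fin 8
Q D x = qnum D x mod 8

record _≅_ (D E : List Atom) : Set where
  field
    to      : Elem D → Elem E
    from    : Elem E → Elem D
    from-to : ∀ x → from (to x) ≡ x
    to-from : ∀ y → to (from y) ≡ y
    to-add  : ∀ x y → to (add D x y) ≡ add E (to x) (to y)
    to-q    : ∀ x → Q E (to x) ≡ Q D x

V4 : Set
V4 = Fin 2 × Fin 2

addV4 : V4 → V4 → V4
addV4 (x , y) (x' , y') = addMod2 x x' , addMod2 y y'

HasIsotropicV4 : List Atom → Set
HasIsotropicV4 D =
  Σ (V4 → Elem D) λ f →
    (∀ u v → f (addV4 u v) ≡ add D (f u) (f v)) ×
    (∀ u v → f u ≡ f v → u ≡ v) ×
    (∀ u → Q D (f u) ≡ fz)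

prodSign : List Sign → Sign
prodSign = foldr _*ₛ_ Sign.+

Is2II : Sign → ℕ → List Atom → Set
Is2II ε n D = Σ (List Plane) λ ps →
  (2 * length ps ≡ n) × (prodSign (map planeSign ps) ≡ ε) × (D ≡ map plane ps)

Is2t : Fin 8 → Sign → ℕ → List Atom → Set
Is2t t ε n D = Σ (List Odd8) λ as →
  (length as ≡ n) × (sum (map oddℕ as) mod 8 ≡ t) ×
  (prodSign (map kronOdd as) ≡ ε) × (D ≡ map odd2 as)

Is4s : Fin 8 → Sign → ℕ → List Atom → Set
Is4s s ε m D = Σ (List Odd8) λ as →
  (length as ≡ m) × (sum (map oddℕ as) mod 8 ≡ s) ×
  (prodSign (map kronOdd as) ≡ ε) × (D ≡ map odd4 as)

-- exponent k ∈ ℤ/8 with ε e(t/8) = e(k/8)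
epsExp : Sign → Fin 8 → Fin 8
epsExp Sign.+ t = t
epsExp Sign.- t = (toℕ t + 4) mod 8

data Listed : List Atom → Set where
  trivial  : Listed []
  ii2      : ∀ ε D → Is2II ε 2 D → Listed D
  ii4minus : ∀ D → Is2II Sign.- 4 D → Listed D
  odd≤3    : ∀ t ε n D → 1 ≤ n → n ≤ 3 → Is2t t ε n D → Listed D
  odd4dim  : ∀ t ε D → epsExp ε t ≢ fz → Is2t t ε 4 D → Listed D
  odd5dim  : ∀ t ε D → (ε ◃ 1) *ℤ kron2 t ≡ -1ℤ → Is2t t ε 5 D → Listed D
  four1    : ∀ s ε D → Is4s s ε 1 D → Listed D
  ii2four1 : ∀ ε s ε' D E → Is2II ε 2 D → Is4s s ε' 1 E → Listed (D ++ E)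
  odd≤3four1 : ∀ t ε n s ε' D E → 1 ≤ n → n ≤ 3 →
               Is2t t ε n D → Is4s s ε' 1 E → Listed (D ++ E)
  four2    : ∀ s ε D → Is4s s ε 2 D → Listed D
  odd1four2 : ∀ t ε s ε' D E → Is2t t ε 1 D → Is4s s ε' 2 E → Listed (D ++ E)

module Submission where

-- An isotropic (ℤ/2ℤ)² is transported along isomorphisms and inherited from
-- orthogonal summands, and for a concrete form its existence is decided by a
-- finite search.  Sorting the atoms and using 2_a ≅ 2_{a+4} brings every form to
-- planes ⊕ 2_1^A ⊕ 2_3^B ⊕ (4-adic atoms); when A + B > 0 the planes are absorbed
-- into the odd part by the relations 2_II^{±2} ⊕ 2_a ≅ 2_b ⊕ 2_c ⊕ 2_d.  A normal
-- form outside the list then contains one of a few small isotropic summands (two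
-- equal planes, three 4-adic atoms, 2_1^2 ⊕ 2_3^2, ...), whereas the normal forms
-- of the listed forms are anisotropic by direct computation.

open import Defs

open import Data.Empty using (⊥-elim)
open import Data.Fin using (Fin; toℕ) renaming (zero to fz; suc to fs)
open import Data.Fin.Properties using (toℕ-fromℕ<; toℕ-injective) renaming (_≟_ to _≟ᶠ_; all? to Fin-all?)
open import Data.Integer using (_◃_; -1ℤ) renaming (_*_ to _*ℤ_; _≟_ to _≟ℤ_)
open import Data.List
  using (List; []; _∷_; _++_; map; foldr; length; replicate; allFin; cartesianProduct; filter)
open import Data.List.Membership.Propositional using (_∈_; lose)
open import Data.List.Membership.Propositional.Properties using (∈-allFin; ∈-cartesianProduct⁺; ∈-filter⁺)
open import Data.List.Properties using (++-identityʳ; length-++; length-replicate)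
open import Data.List.Relation.Binary.Permutation.Propositional as ↭ using (_↭_; ↭-sym; ↭-trans)
open import Data.List.Relation.Binary.Permutation.Propositional.Properties
  using (shift) renaming (++⁺ˡ to ↭-++⁺ˡ; ++⁺ʳ to ↭-++⁺ʳ; map⁺ to ↭-map⁺)
open import Data.List.Relation.Binary.Sublist.Propositional using (_⊆_; []; _∷_; _∷ʳ_; minimum; ⊆-refl)
open import Data.List.Relation.Binary.Sublist.Propositional.Properties
  using (++⁺; ++⁺ˡ) renaming (map⁺ to ⊆-map⁺)
open import Data.List.Relation.Unary.All using (all?; lookup; tabulate)
open import Data.List.Relation.Unary.Any using (Any; here; any?; satisfied)
open import Data.Nat using (ℕ; zero; suc; _+_; _*_; _∸_; _≤_; z≤n; s≤s; NonZero; _%_)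
open import Data.Nat.DivMod using (_mod_; %-distribˡ-+)
open import Data.Nat.ListAction using (sum)
open import Data.Nat.Properties
  using (_≤?_; _≟_; *-zeroʳ; suc-injective; +-suc; +-assoc; +-comm; +-identityʳ; +-mono-≤; *-cancelˡ-≡;
         ≤-refl; ≤-reflexive; ≤-trans; ≤-total; ≰⇒>; m≤m+n; m≤n+m; n≤1+n; m+[n∸m]≡n; m≤n+o⇒m∸n≤o; allUpTo?)
open import Data.Product using (Σ; ∃; ∃₂; _×_; _,_; proj₁; proj₂; uncurry)
open import Data.Product.Properties using (≡-dec; ,-injectiveˡ; ,-injectiveʳ)
open import Data.Sign using (Sign) renaming (_≟_ to _≟ˢ_)
open import Data.Sum using (_⊎_; inj₁; inj₂)
open import Data.Unit using (⊤; tt)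
open import Data.Unit.Properties using () renaming (_≟_ to _≟ᵘ_)
open import Function using (id; _∘_)
open import Function.Bundles using (_⇔_; mk⇔)
open import Relation.Binary.Bundles using (Setoid)
open import Relation.Binary.Definitions using (DecidableEquality)
open import Relation.Binary.PropositionalEquality
  using (_≡_; _≢_; refl; sym; trans; cong; cong₂; subst; module ≡-Reasoning)
import Relation.Binary.Reasoning.Setoid as SetoidReasoning
open import Relation.Nullary using (¬_; Dec; yes; no; ¬?)
open import Relation.Nullary.Decidable using (True; toWitness; map′; _×-dec_; _→-dec_; from-yes)

mod⇒% : ∀ {m n d} .{{_ : NonZero d}} → m mod d ≡ n mod d → m % d ≡ n % d
mod⇒% e = trans (sym (toℕ-fromℕ< _)) (trans (cong toℕ e) (toℕ-fromℕ< _))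

%⇒mod : ∀ {m n d} .{{_ : NonZero d}} → m % d ≡ n % d → m mod d ≡ n mod d
%⇒mod e = toℕ-injective (trans (toℕ-fromℕ< _) (trans e (sym (toℕ-fromℕ< _))))

mod-cong-+ : ∀ {d} .{{_ : NonZero d}} m m' n n' →
  m mod d ≡ m' mod d → n mod d ≡ n' mod d → (m + n) mod d ≡ (m' + n') mod d
mod-cong-+ {d} m m' n n' e₁ e₂ = %⇒mod (trans (%-distribˡ-+ m n d)
  (trans (cong₂ (λ u v → (u + v) % d) (mod⇒% e₁) (mod⇒% e₂)) (sym (%-distribˡ-+ m' n' d))))

record _↣_ (D E : List Atom) : Set where
  field
    embed           : Elem D → Elem E
    embed-injective : ∀ {x y} → embed x ≡ embed y → x ≡ y
    embed-add       : ∀ x y → embed (add D x y) ≡ add E (embed x) (embed y)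
    embed-q         : ∀ x → Q E (embed x) ≡ Q D x

open _↣_
open _≅_

Q-∷-cong : ∀ a x {D E} (r : Elem D) (s : Elem E) →
  Q E s ≡ Q D r → Q (a ∷ E) (x , s) ≡ Q (a ∷ D) (x , r)
Q-∷-cong a x {D} {E} r s = mod-cong-+ (aQ a x) (aQ a x) (qnum E s) (qnum D r) refl

HasIsotropicV4-mono : ∀ {D E} → D ↣ E → HasIsotropicV4 D → HasIsotropicV4 E
HasIsotropicV4-mono e (f , hom , inj , iso) =
  embed e ∘ f ,
  (λ u v → trans (cong (embed e) (hom u v)) (embed-add e _ _)) ,
  (λ u v eq → inj u v (embed-injective e eq)) ,
  (λ u → trans (embed-q e (f u)) (iso u))

aAdd-zero : (a : Atom) → aAdd a (aZero a) (aZero a) ≡ aZero a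
aAdd-zero (plane _) = refl
aAdd-zero (odd2 _)  = refl
aAdd-zero (odd4 _)  = refl

aQ-zero : (a : Atom) → aQ a (aZero a) ≡ 0
aQ-zero (plane hypP) = refl
aQ-zero (plane ellP) = refl
aQ-zero (odd2 a)     = cong (2 *_) (*-zeroʳ (oddℕ a))
aQ-zero (odd4 a)     = *-zeroʳ (oddℕ a)

↣-∷ : ∀ a {D E} → D ↣ E → (a ∷ D) ↣ (a ∷ E)
↣-∷ a e = record
  { embed           = λ (x , r) → x , embed e r
  ; embed-injective = λ eq → cong₂ _,_ (,-injectiveˡ eq) (embed-injective e (,-injectiveʳ eq))
  ; embed-add       = λ (x , r) (y , s) → cong (aAdd a x y ,_) (embed-add e r s)
  ; embed-q         = λ (x , r) → Q-∷-cong a x r (embed e r) (embed-q e r)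
  }

↣-skip : ∀ a {D E} → D ↣ E → D ↣ (a ∷ E)
↣-skip a e = record
  { embed           = λ r → aZero a , embed e r
  ; embed-injective = λ eq → embed-injective e (,-injectiveʳ eq)
  ; embed-add       = λ r s → cong₂ _,_ (sym (aAdd-zero a)) (embed-add e r s)
  ; embed-q         = λ r → trans (cong (λ n → (n + _) mod 8) (aQ-zero a)) (embed-q e r)
  }

⊆⇒↣ : ∀ {D E} → D ⊆ E → D ↣ E
⊆⇒↣ []         = record { embed = id ; embed-injective = id ; embed-add = λ _ _ → refl ; embed-q = λ _ → refl }
⊆⇒↣ (a ∷ʳ p)   = ↣-skip a (⊆⇒↣ p)
⊆⇒↣ (refl ∷ p) = ↣-∷ _ (⊆⇒↣ p)

≅⇒↣ : ∀ {D E} → D ≅ E → D ↣ E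
≅⇒↣ i = record
  { embed           = to i
  ; embed-injective = λ {x} {y} eq → trans (sym (from-to i x)) (trans (cong (from i) eq) (from-to i y))
  ; embed-add       = to-add i
  ; embed-q         = to-q i
  }

≅-refl : ∀ {D} → D ≅ D
≅-refl = record
  { to = id ; from = id ; from-to = λ _ → refl ; to-from = λ _ → refl
  ; to-add = λ _ _ → refl ; to-q = λ _ → refl }

≅-sym : ∀ {D E} → D ≅ E → E ≅ D
≅-sym {D} {E} i = record
  { to      = from i
  ; from    = to i
  ; from-to = to-from i
  ; to-from = from-to i
  ; to-add  = λ x y → embed-injective (≅⇒↣ i) (begin
      to i (from i (add E x y))                          ≡⟨ to-from i _ ⟩
      add E x y                                              ≡⟨ cong₂ (add E) (sym (to-from i x)) (sym (to-from i y)) ⟩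
      add E (to i (from i x)) (to i (from i y))      ≡⟨ sym (to-add i _ _) ⟩
      to i (add D (from i x) (from i y))                 ∎)
  ; to-q    = λ y → trans (sym (to-q i (from i y))) (cong (Q E) (to-from i y))
  }
  where open ≡-Reasoning

≅-trans : ∀ {D E F} → D ≅ E → E ≅ F → D ≅ F
≅-trans i j = record
  { to      = to j ∘ to i
  ; from    = from i ∘ from j
  ; from-to = λ x → trans (cong (from i) (from-to j _)) (from-to i x)
  ; to-from = λ z → trans (cong (to j) (to-from i _)) (to-from j z)
  ; to-add  = λ x y → trans (cong (to j) (to-add i x y)) (to-add j _ _)
  ; to-q    = λ x → trans (to-q j _) (to-q i x)
  }

≅-setoid : Setoid _ _
≅-setoid = record
  { Carrier = List Atom
  ; _≈_ = _≅_
  ; isEquivalence = record { refl = ≅-refl ; sym = ≅-sym ; trans = ≅-trans }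
  }

module ≅-Reasoning = SetoidReasoning ≅-setoid

≅-∷ : ∀ a {D E} → D ≅ E → (a ∷ D) ≅ (a ∷ E)
≅-∷ a i = record
  { to      = λ (x , r) → x , to i r
  ; from    = λ (x , r) → x , from i r
  ; from-to = λ (x , r) → cong (x ,_) (from-to i r)
  ; to-from = λ (x , r) → cong (x ,_) (to-from i r)
  ; to-add  = λ (x , r) (y , s) → cong (aAdd a x y ,_) (to-add i r s)
  ; to-q    = λ (x , r) → Q-∷-cong a x r (to i r) (to-q i r)
  }

≅-swap : ∀ a b D → (a ∷ b ∷ D) ≅ (b ∷ a ∷ D)
≅-swap a b D = record
  { to      = λ (x , y , r) → y , x , r
  ; from    = λ (y , x , r) → x , y , r
  ; from-to = λ _ → refl
  ; to-from = λ _ → refl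
  ; to-add  = λ _ _ → refl
  ; to-q    = λ (x , y , r) → cong (_mod 8) (+-exchange (aQ b y) (aQ a x) (qnum D r))
  }
  where
  +-exchange : ∀ m n o → m + (n + o) ≡ n + (m + o)
  +-exchange m n o = trans (sym (+-assoc m n o)) (trans (cong (_+ o) (+-comm m n)) (+-assoc n m o))

↭⇒≅ : ∀ {D E} → D ↭ E → D ≅ E
↭⇒≅ ↭.refl          = ≅-refl
↭⇒≅ (↭.prep a p)    = ≅-∷ a (↭⇒≅ p)
↭⇒≅ (↭.swap a b p)  = ≅-trans (≅-swap a b _) (≅-∷ b (≅-∷ a (↭⇒≅ p)))
↭⇒≅ (↭.trans p q)   = ≅-trans (↭⇒≅ p) (↭⇒≅ q)

join : (X : List Atom) {T : List Atom} → Elem X → Elem T → Elem (X ++ T)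
join []      _        r = r
join (a ∷ X) (x , xs) r = x , join X xs r

split : (X : List Atom) {T : List Atom} → Elem (X ++ T) → Elem X × Elem T
split []      r       = tt , r
split (a ∷ X) (x , z) = (x , proj₁ (split X z)) , proj₂ (split X z)

split-join : ∀ X {T} (x : Elem X) (r : Elem T) → split X (join X x r) ≡ (x , r)
split-join []      tt       r = refl
split-join (a ∷ X) (x , xs) r = cong (λ (xs' , r') → (x , xs') , r') (split-join X xs r)

join-elim : ∀ X {T} (P : Elem (X ++ T) → Set) → (∀ x r → P (join X x r)) → ∀ z → P z
join-elim []      P h z       = h tt z
join-elim (a ∷ X) P h (x , z) = join-elim X (λ z → P (x , z)) (λ xs r → h (x , xs) r) z

join-add : ∀ X {T} (x y : Elem X) (r s : Elem T) →
  add (X ++ T) (join X x r) (join X y s) ≡ join X (add X x y) (add T r s)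
join-add []      tt       tt       r s = refl
join-add (a ∷ X) (x , xs) (y , ys) r s = cong (aAdd a x y ,_) (join-add X xs ys r s)

join-qnum : ∀ X {T} (x : Elem X) (r : Elem T) → qnum (X ++ T) (join X x r) ≡ qnum X x + qnum T r
join-qnum []      tt       r = refl
join-qnum (a ∷ X) (x , xs) r = trans (cong (aQ a x +_) (join-qnum X xs r)) (sym (+-assoc (aQ a x) _ _))

≅-++ʳ : ∀ {X Y} → X ≅ Y → (T : List Atom) → (X ++ T) ≅ (Y ++ T)
≅-++ʳ {X} {Y} i T = record
  { to      = along X Y t
  ; from    = along Y X f
  ; from-to = join-elim X _ λ x r → trans (cong (along Y X f) (along-join X Y t x r))
                                           (trans (along-join Y X f (t x) r) (cong (λ x → join X x r) (from-to i x)))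
  ; to-from = join-elim Y _ λ y r → trans (cong (along X Y t) (along-join Y X f y r))
                                           (trans (along-join X Y t (f y) r) (cong (λ y → join Y y r) (to-from i y)))
  ; to-add  = join-elim X _ λ x r → join-elim X _ λ y s → to-add-join x y r s
  ; to-q    = join-elim X _ to-q-join
  }
  where
  open ≡-Reasoning
  t = to i
  f = from i

  along : ∀ X Y → (Elem X → Elem Y) → Elem (X ++ T) → Elem (Y ++ T)
  along X Y g z = join Y (g (proj₁ (split X z))) (proj₂ (split X z))

  along-join : ∀ X Y g x (r : Elem T) → along X Y g (join X x r) ≡ join Y (g x) r
  along-join X Y g x r = cong (λ (x , r) → join Y (g x) r) (split-join X x r)

  to-add-join : ∀ x y r s → along X Y t (add (X ++ T) (join X x r) (join X y s))
                          ≡ add (Y ++ T) (along X Y t (join X x r)) (along X Y t (join X y s))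
  to-add-join x y r s = begin
    along X Y t (add (X ++ T) (join X x r) (join X y s))  ≡⟨ cong (along X Y t) (join-add X x y r s) ⟩
    along X Y t (join X (add X x y) (add T r s))          ≡⟨ along-join X Y t (add X x y) (add T r s) ⟩
    join Y (t (add X x y)) (add T r s)                    ≡⟨ cong (λ w → join Y w (add T r s)) (to-add i x y) ⟩
    join Y (add Y (t x) (t y)) (add T r s)                ≡⟨ sym (join-add Y (t x) (t y) r s) ⟩
    add (Y ++ T) (join Y (t x) r) (join Y (t y) s)
      ≡⟨ sym (cong₂ (add (Y ++ T)) (along-join X Y t x r) (along-join X Y t y s)) ⟩
    add (Y ++ T) (along X Y t (join X x r)) (along X Y t (join X y s)) ∎

  to-q-join : ∀ x r → Q (Y ++ T) (along X Y t (join X x r)) ≡ Q (X ++ T) (join X x r)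
  to-q-join x r = begin
    Q (Y ++ T) (along X Y t (join X x r))   ≡⟨ cong (Q (Y ++ T)) (along-join X Y t x r) ⟩
    qnum (Y ++ T) (join Y (t x) r) mod 8    ≡⟨ cong (_mod 8) (join-qnum Y (t x) r) ⟩
    (qnum Y (t x) + qnum T r) mod 8         ≡⟨ mod-cong-+ (qnum Y (t x)) (qnum X x) (qnum T r) (qnum T r) (to-q i x) refl ⟩
    (qnum X x + qnum T r) mod 8             ≡⟨ cong (_mod 8) (sym (join-qnum X x r)) ⟩
    Q (X ++ T) (join X x r)                 ∎

-- Deciding the existence of an isotropic (ℤ/2ℤ)²

elementsA : (a : Atom) → List (AElem a)
elementsA (plane _) = cartesianProduct (allFin 2) (allFin 2)
elementsA (odd2 _)  = allFin 2
elementsA (odd4 _)  = allFin 4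

∈-elementsA : (a : Atom) (x : AElem a) → x ∈ elementsA a
∈-elementsA (plane _) (x , y) = ∈-cartesianProduct⁺ (∈-allFin x) (∈-allFin y)
∈-elementsA (odd2 _)  x       = ∈-allFin x
∈-elementsA (odd4 _)  x       = ∈-allFin x

elements : (D : List Atom) → List (Elem D)
elements []      = tt ∷ []
elements (a ∷ D) = cartesianProduct (elementsA a) (elements D)

∈-elements : (D : List Atom) (x : Elem D) → x ∈ elements D
∈-elements []      tt       = here refl
∈-elements (a ∷ D) (x , xs) = ∈-cartesianProduct⁺ (∈-elementsA a x) (∈-elements D xs)

_≟A_ : {a : Atom} → DecidableEquality (AElem a)
_≟A_ {plane _} = ≡-dec _≟ᶠ_ _≟ᶠ_
_≟A_ {odd2 _}  = _≟ᶠ_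
_≟A_ {odd4 _}  = _≟ᶠ_

_≟E_ : {D : List Atom} → DecidableEquality (Elem D)
_≟E_ {[]}    = _≟ᵘ_
_≟E_ {a ∷ D} = ≡-dec _≟A_ _≟E_

∀-Elem? : (D : List Atom) {P : Elem D → Set} → (∀ x → Dec (P x)) → Dec (∀ x → P x)
∀-Elem? D P? = map′ (λ h x → lookup h (∈-elements D x)) (λ h → tabulate λ {x} _ → h x) (all? P? (elements D))

∀-V4? : {P : V4 → Set} → (∀ u → Dec (P u)) → Dec (∀ u → P u)
∀-V4? P? = map′ (λ h (i , j) → h i j) (λ h i j → h (i , j)) (Fin-all? λ i → Fin-all? λ j → P? (i , j))

IsIsotropicEmbedding : (D : List Atom) → (V4 → Elem D) → Set
IsIsotropicEmbedding D f =
  (∀ u v → f (addV4 u v) ≡ add D (f u) (f v)) ×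
  (∀ u v → f u ≡ f v → u ≡ v) ×
  (∀ u → Q D (f u) ≡ fz)

IsIsotropicEmbedding-resp : ∀ {D f g} → (∀ u → f u ≡ g u) → IsIsotropicEmbedding D f → IsIsotropicEmbedding D g
IsIsotropicEmbedding-resp {D} f≗g (hom , inj , iso) =
  (λ u v → trans (sym (f≗g _)) (trans (hom u v) (cong₂ (add D) (f≗g u) (f≗g v)))) ,
  (λ u v eq → inj u v (trans (f≗g u) (trans eq (sym (f≗g v))))) ,
  (λ u → trans (cong (Q D) (sym (f≗g u))) (iso u))

isIsotropicEmbedding? : (D : List Atom) (f : V4 → Elem D) → Dec (IsIsotropicEmbedding D f)
isIsotropicEmbedding? D f =
  map′ (λ (iso , hom , inj) → hom , inj , iso) (λ (hom , inj , iso) → iso , hom , inj)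
    (∀-V4? (λ u → Q D (f u) ≟ᶠ fz) ×-dec
     ∀-V4? (λ u → ∀-V4? λ v → f (addV4 u v) ≟E add D (f u) (f v)) ×-dec
     ∀-V4? (λ u → ∀-V4? λ v → f u ≟E f v →-dec ≡-dec _≟ᶠ_ _≟ᶠ_ u v))

-- The value x + x (rather than 0) at (0,0) makes span agree with any additive f
-- sending the generators to x and y, without using cancellation in Elem D.
span : (D : List Atom) → Elem D → Elem D → V4 → Elem D
span D x y (fz    , fz)    = add D x x
span D x y (fs fz , fz)    = x
span D x y (fz    , fs fz) = y
span D x y (fs fz , fs fz) = add D x y

span-generators : ∀ {D} (f : V4 → Elem D) → (∀ u v → f (addV4 u v) ≡ add D (f u) (f v)) →
  ∀ u → span D (f (fs fz , fz)) (f (fz , fs fz)) u ≡ f u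
span-generators f hom (fz    , fz)    = sym (hom (fs fz , fz) (fs fz , fz))
span-generators f hom (fs fz , fz)    = refl
span-generators f hom (fz    , fs fz) = refl
span-generators f hom (fs fz , fs fz) = sym (hom (fs fz , fz) (fz , fs fz))

-- 3x = x rather than 2x = 0, for the same reason as in span.
isotropicInvolutions : (D : List Atom) → List (Elem D)
isotropicInvolutions D = filter (λ x → Q D x ≟ᶠ fz ×-dec add D (add D x x) x ≟E x) (elements D)

∈-isotropicInvolutions : ∀ {D} (f : V4 → Elem D) → IsIsotropicEmbedding D f →
  ∀ u → f u ∈ isotropicInvolutions D
∈-isotropicInvolutions {D} f (hom , _ , iso) u =
  ∈-filter⁺ _ (∈-elements D (f u)) (iso u , (begin
    add D (add D (f u) (f u)) (f u)   ≡⟨ cong (λ w → add D w (f u)) (sym (hom u u)) ⟩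
    add D (f (addV4 u u)) (f u)       ≡⟨ sym (hom (addV4 u u) u) ⟩
    f (addV4 (addV4 u u) u)           ≡⟨ cong f (addV4-triple u) ⟩
    f u                               ∎))
  where
  open ≡-Reasoning
  addV4-triple : ∀ u → addV4 (addV4 u u) u ≡ u
  addV4-triple (fz    , fz)    = refl
  addV4-triple (fz    , fs fz) = refl
  addV4-triple (fs fz , fz)    = refl
  addV4-triple (fs fz , fs fz) = refl

hasIsotropicV4? : (D : List Atom) → Dec (HasIsotropicV4 D)
hasIsotropicV4? D = map′ sound complete (any? (λ (x , y) → isIsotropicEmbedding? D (span D x y)) pairs)
  where
  pairs : List (Elem D × Elem D)
  pairs = cartesianProduct (isotropicInvolutions D) (isotropicInvolutions D)

  Spans : Elem D × Elem D → Set
  Spans (x , y) = IsIsotropicEmbedding D (span D x y)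

  sound : Any Spans pairs → HasIsotropicV4 D
  sound any with satisfied any
  ... | (x , y) , emb = span D x y , emb

  complete : HasIsotropicV4 D → Any Spans pairs
  complete (f , emb@(hom , _)) =
    lose (∈-cartesianProduct⁺ (∈-isotropicInvolutions f emb _) (∈-isotropicInvolutions f emb _))
         (IsIsotropicEmbedding-resp (λ u → sym (span-generators f hom u)) emb)

-- Normal form

IsoLaws : (D E : List Atom) → (Elem D → Elem E) → (Elem E → Elem D) → Set
IsoLaws D E t f =
  (∀ x → f (t x) ≡ x) × (∀ y → t (f y) ≡ y) ×
  (∀ x y → t (add D x y) ≡ add E (t x) (t y)) × (∀ x → Q E (t x) ≡ Q D x)

isoLaws? : ∀ D E t f → Dec (IsoLaws D E t f)
isoLaws? D E t f =
  ∀-Elem? D (λ x → f (t x) ≟E x) ×-dec ∀-Elem? E (λ y → t (f y) ≟E y) ×-dec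
  ∀-Elem? D (λ x → ∀-Elem? D λ y → t (add D x y) ≟E add E (t x) (t y)) ×-dec
  ∀-Elem? D (λ x → Q E (t x) ≟ᶠ Q D x)

≅-by-computation : ∀ {D E} (t : Elem D → Elem E) (f : Elem E → Elem D) → {True (isoLaws? D E t f)} → D ≅ E
≅-by-computation t f {laws} with toWitness laws
... | ft , tf , t-add , t-q = record
  { to = t ; from = f ; from-to = ft ; to-from = tf ; to-add = t-add ; to-q = t-q }

2₅≅2₁ : (odd2 o5 ∷ []) ≅ (odd2 o1 ∷ [])
2₅≅2₁ = ≅-by-computation id id

2₇≅2₃ : (odd2 o7 ∷ []) ≅ (odd2 o3 ∷ [])
2₇≅2₃ = ≅-by-computation id id

absorbMap : (Fin 2 × Fin 2) × Fin 2 × ⊤ → Fin 2 × Fin 2 × Fin 2 × ⊤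
absorbMap ((x₁ , x₂) , x₃ , _) = addMod2 x₂ x₃ , addMod2 x₁ x₃ , addMod2 (addMod2 x₁ x₂) x₃ , tt

absorbMap⁻¹ : Fin 2 × Fin 2 × Fin 2 × ⊤ → (Fin 2 × Fin 2) × Fin 2 × ⊤
absorbMap⁻¹ (y₁ , y₂ , y₃ , _) = (addMod2 y₁ y₃ , addMod2 y₂ y₃) , addMod2 (addMod2 y₁ y₂) y₃ , tt

-- All four relations 2_II^{±2} ⊕ 2_a ≅ 2_b ⊕ 2_c ⊕ 2_d used below are
-- realised by this one linear map.
absorb : ∀ {p a b c d} →
  {laws : True (isoLaws? (plane p ∷ odd2 a ∷ []) (odd2 b ∷ odd2 c ∷ odd2 d ∷ []) absorbMap absorbMap⁻¹)} →
  (plane p ∷ odd2 a ∷ []) ≅ (odd2 b ∷ odd2 c ∷ odd2 d ∷ [])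
absorb {p} {a} {b} {c} {d} {laws} =
  ≅-by-computation {plane p ∷ odd2 a ∷ []} {odd2 b ∷ odd2 c ∷ odd2 d ∷ []} absorbMap absorbMap⁻¹ {laws}

hyp⊕2₁ : (plane hypP ∷ odd2 o1 ∷ []) ≅ (odd2 o1 ∷ odd2 o1 ∷ odd2 o3 ∷ [])
hyp⊕2₁ = absorb

hyp⊕2₃ : (plane hypP ∷ odd2 o3 ∷ []) ≅ (odd2 o3 ∷ odd2 o3 ∷ odd2 o1 ∷ [])
hyp⊕2₃ = absorb

ell⊕2₁ : (plane ellP ∷ odd2 o1 ∷ []) ≅ (odd2 o3 ∷ odd2 o3 ∷ odd2 o3 ∷ [])
ell⊕2₁ = absorb

ell⊕2₃ : (plane ellP ∷ odd2 o3 ∷ []) ≅ (odd2 o1 ∷ odd2 o1 ∷ odd2 o1 ∷ [])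
ell⊕2₃ = absorb

oddForm : ℕ → ℕ → List Odd8
oddForm A B = replicate A o1 ++ replicate B o3

-- Since 2_a ≅ 2_{a+4}, only a mod 4 matters for an odd summand on ℤ/2;
-- odds counts the summands with a ≡ 1 and with a ≡ 3 (mod 4).
record Parts : Set where
  constructor ⟨_,_,_⟩
  field
    planes : List Plane
    odds   : ℕ × ℕ
    fours  : List Odd8

⟦_⟧ : Parts → List Atom
⟦ ⟨ ps , (A , B) , bs ⟩ ⟧ = map plane ps ++ map odd2 (oddForm A B) ++ map odd4 bs

bump : Odd8 → ℕ × ℕ → ℕ × ℕ
bump o1 (A , B) = suc A , B
bump o5 (A , B) = suc A , B
bump o3 (A , B) = A , suc B
bump o7 (A , B) = A , suc B

insert : Atom → Parts → Parts
insert (plane p) ⟨ ps , c , bs ⟩ = ⟨ p ∷ ps , c , bs ⟩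
insert (odd2 a)  ⟨ ps , c , bs ⟩ = ⟨ ps , bump a c , bs ⟩
insert (odd4 b)  ⟨ ps , c , bs ⟩ = ⟨ ps , c , b ∷ bs ⟩

decompose : List Atom → Parts
decompose = foldr insert ⟨ [] , (0 , 0) , [] ⟩

∷-↭ : ∀ {A : Set} (v : A) xs ys → v ∷ xs ++ ys ↭ xs ++ v ∷ ys
∷-↭ v xs ys = ↭-sym (shift v xs ys)

≅-insert : (a : Atom) (P : Parts) → (a ∷ ⟦ P ⟧) ≅ ⟦ insert a P ⟧
≅-insert (plane p) P = ≅-refl
≅-insert (odd2 o1) ⟨ ps , (A , B) , bs ⟩ = ↭⇒≅ (∷-↭ _ (map plane ps) _)
≅-insert (odd2 o5) P = ≅-trans (≅-++ʳ 2₅≅2₁ ⟦ P ⟧) (≅-insert (odd2 o1) P)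
≅-insert (odd2 o3) ⟨ ps , (A , B) , bs ⟩ = ↭⇒≅ (↭-trans (∷-↭ _ (map plane ps) _)
  (↭-++⁺ˡ (map plane ps) (↭-++⁺ʳ (map odd4 bs) (↭-map⁺ odd2 (∷-↭ o3 (replicate A o1) (replicate B o3))))))
≅-insert (odd2 o7) P = ≅-trans (≅-++ʳ 2₇≅2₃ ⟦ P ⟧) (≅-insert (odd2 o3) P)
≅-insert (odd4 b) ⟨ ps , (A , B) , bs ⟩ = ↭⇒≅ (↭-trans (∷-↭ _ (map plane ps) _)
  (↭-++⁺ˡ (map plane ps) (∷-↭ _ (map odd2 (oddForm A B)) (map odd4 bs))))

≅-decompose : (D : List Atom) → D ≅ ⟦ decompose D ⟧
≅-decompose []      = ≅-refl
≅-decompose (a ∷ D) = ≅-trans (≅-∷ a (≅-decompose D)) (≅-insert a (decompose D))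

-- o1^A o3^B then contains 2_1 ⊕ 2_1 ⊕ 2_3 ⊕ 2_3, which is isotropic.
Mixed : ℕ → ℕ → Set
Mixed A B = 2 ≤ A × 2 ≤ B

mixed? : ∀ A B → Dec (Mixed A B)
mixed? A B = 2 ≤? A ×-dec 2 ≤? B

tally : List Odd8 → ℕ × ℕ
tally = foldr bump (0 , 0)

≅-tally : (as bs : List Odd8) → (map odd2 as ++ map odd4 bs) ≅ ⟦ ⟨ [] , tally as , bs ⟩ ⟧
≅-tally []       bs = ≅-refl
≅-tally (a ∷ as) bs = ≅-trans (≅-∷ (odd2 a) (≅-tally as bs)) (≅-insert (odd2 a) ⟨ [] , tally as , bs ⟩)

∀-Plane? : {P : Plane → Set} → (∀ p → Dec (P p)) → Dec (∀ p → P p)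
∀-Plane? P? = map′ (λ (h , e) → λ { hypP → h ; ellP → e }) (λ h → h hypP , h ellP) (P? hypP ×-dec P? ellP)

∀-Odd8? : {P : Odd8 → Set} → (∀ a → Dec (P a)) → Dec (∀ a → P a)
∀-Odd8? P? =
  map′ (λ (h₁ , h₃ , h₅ , h₇) → λ { o1 → h₁ ; o3 → h₃ ; o5 → h₅ ; o7 → h₇ })
       (λ h → h o1 , h o3 , h o5 , h o7)
       (P? o1 ×-dec P? o3 ×-dec P? o5 ×-dec P? o7)

∀-length? : {P : List Odd8 → Set} → (∀ as → Dec (P as)) → (n : ℕ) → Dec (∀ as → length as ≡ n → P as)
∀-length? P? zero    = map′ (λ p → λ { [] _ → p }) (λ h → h [] refl) (P? [])
∀-length? P? (suc n) =
  map′ (λ h → λ { [] () ; (a ∷ as) eq → h a as (suc-injective eq) })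
       (λ h a as eq → h (a ∷ as) (cong suc eq))
       (∀-Odd8? λ a → ∀-length? (λ as → P? (a ∷ as)) n)

∀-rank≤? : {P : ℕ → ℕ → Set} → (∀ A B → Dec (P A B)) → (n : ℕ) → Dec (∀ A B → A + B ≤ n → P A B)
∀-rank≤? P? n =
  map′ (λ h A B r → h (s≤s (≤-trans (m≤m+n A B) r)) (s≤s (≤-trans (m≤n+m B A) r)) r)
       (λ h {A} _ {B} _ r → h A B r)
       (allUpTo? (λ A → allUpTo? (λ B → A + B ≤? n →-dec P? A B) (suc n)) (suc n))

∀-rank≡? : {P : ℕ → ℕ → Set} → (∀ A B → Dec (P A B)) → (n : ℕ) → Dec (∀ A B → A + B ≡ n → P A B)
∀-rank≡? P? n = map′ (λ h A B e → h A B (≤-reflexive e) e) (λ h A B _ e → h A B e)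
                     (∀-rank≤? (λ A B → A + B ≟ n →-dec P? A B) n)

isotropic-plane² : ∀ p → HasIsotropicV4 (plane p ∷ plane p ∷ [])
isotropic-plane² = from-yes (∀-Plane? λ p → hasIsotropicV4? (plane p ∷ plane p ∷ []))

isotropic-plane-plane-four : ∀ p q b → HasIsotropicV4 (plane p ∷ plane q ∷ odd4 b ∷ [])
isotropic-plane-plane-four = from-yes (∀-Plane? λ p → ∀-Plane? λ q → ∀-Odd8? λ b →
  hasIsotropicV4? (plane p ∷ plane q ∷ odd4 b ∷ []))

isotropic-plane-four² : ∀ p b c → HasIsotropicV4 (plane p ∷ odd4 b ∷ odd4 c ∷ [])
isotropic-plane-four² = from-yes (∀-Plane? λ p → ∀-Odd8? λ b → ∀-Odd8? λ c →
  hasIsotropicV4? (plane p ∷ odd4 b ∷ odd4 c ∷ []))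

isotropic-four³ : ∀ b c d → HasIsotropicV4 (odd4 b ∷ odd4 c ∷ odd4 d ∷ [])
isotropic-four³ = from-yes (∀-Odd8? λ b → ∀-Odd8? λ c → ∀-Odd8? λ d →
  hasIsotropicV4? (odd4 b ∷ odd4 c ∷ odd4 d ∷ []))

isotropic-odd-2-2 : HasIsotropicV4 ⟦ ⟨ [] , (2 , 2) , [] ⟩ ⟧
isotropic-odd-2-2 = from-yes (hasIsotropicV4? ⟦ ⟨ [] , (2 , 2) , [] ⟩ ⟧)

isotropic-rank6 : ∀ A B → A + B ≡ 6 → HasIsotropicV4 ⟦ ⟨ [] , (A , B) , [] ⟩ ⟧
isotropic-rank6 = from-yes (∀-rank≡? (λ A B → hasIsotropicV4? ⟦ ⟨ [] , (A , B) , [] ⟩ ⟧) 6)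

isotropic-rank4-four : ∀ A B → A + B ≡ 4 → ∀ b → HasIsotropicV4 ⟦ ⟨ [] , (A , B) , b ∷ [] ⟩ ⟧
isotropic-rank4-four = from-yes (∀-rank≡? (λ A B → ∀-Odd8? λ b →
  hasIsotropicV4? ⟦ ⟨ [] , (A , B) , b ∷ [] ⟩ ⟧) 4)

isotropic-rank2-four² : ∀ A B → A + B ≡ 2 → ∀ b c → HasIsotropicV4 ⟦ ⟨ [] , (A , B) , b ∷ c ∷ [] ⟩ ⟧
isotropic-rank2-four² = from-yes (∀-rank≡? (λ A B → ∀-Odd8? λ b → ∀-Odd8? λ c →
  hasIsotropicV4? ⟦ ⟨ [] , (A , B) , b ∷ c ∷ [] ⟩ ⟧) 2)

anisotropic-plane : ∀ p → ¬ HasIsotropicV4 (plane p ∷ [])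
anisotropic-plane = from-yes (∀-Plane? λ p → ¬? (hasIsotropicV4? (plane p ∷ [])))

anisotropic-plane-four : ∀ p b → ¬ HasIsotropicV4 (plane p ∷ odd4 b ∷ [])
anisotropic-plane-four = from-yes (∀-Plane? λ p → ∀-Odd8? λ b → ¬? (hasIsotropicV4? (plane p ∷ odd4 b ∷ [])))

anisotropic-2II⁻⁴ : ∀ p q → prodSign (map planeSign (p ∷ q ∷ [])) ≡ Sign.- → ¬ HasIsotropicV4 (plane p ∷ plane q ∷ [])
anisotropic-2II⁻⁴ = from-yes (∀-Plane? λ p → ∀-Plane? λ q →
  prodSign (map planeSign (p ∷ q ∷ [])) ≟ˢ Sign.- →-dec ¬? (hasIsotropicV4? (plane p ∷ plane q ∷ [])))

anisotropic-odd : ∀ A B → A + B ≤ 5 → ¬ Mixed A B → ¬ HasIsotropicV4 ⟦ ⟨ [] , (A , B) , [] ⟩ ⟧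
anisotropic-odd = from-yes (∀-rank≤? (λ A B → ¬? (mixed? A B) →-dec
  ¬? (hasIsotropicV4? ⟦ ⟨ [] , (A , B) , [] ⟩ ⟧)) 5)

anisotropic-odd-four : ∀ A B → A + B ≤ 3 → ∀ b → ¬ HasIsotropicV4 ⟦ ⟨ [] , (A , B) , b ∷ [] ⟩ ⟧
anisotropic-odd-four = from-yes (∀-rank≤? (λ A B → ∀-Odd8? λ b →
  ¬? (hasIsotropicV4? ⟦ ⟨ [] , (A , B) , b ∷ [] ⟩ ⟧)) 3)

anisotropic-odd-four² : ∀ A B → A + B ≤ 1 → ∀ b c → ¬ HasIsotropicV4 ⟦ ⟨ [] , (A , B) , b ∷ c ∷ [] ⟩ ⟧
anisotropic-odd-four² = from-yes (∀-rank≤? (λ A B → ∀-Odd8? λ b → ∀-Odd8? λ c →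
  ¬? (hasIsotropicV4? ⟦ ⟨ [] , (A , B) , b ∷ c ∷ [] ⟩ ⟧)) 1)

oddity : List Odd8 → Fin 8
oddity as = sum (map oddℕ as) mod 8

oddSign : List Odd8 → Sign
oddSign as = prodSign (map kronOdd as)

Admissible₄ : List Odd8 → Set
Admissible₄ as = epsExp (oddSign as) (oddity as) ≢ fz

Admissible₅ : List Odd8 → Set
Admissible₅ as = (oddSign as ◃ 1) *ℤ kron2 (oddity as) ≡ -1ℤ

admissible₄? : ∀ as → Dec (Admissible₄ as)
admissible₄? as = ¬? (epsExp (oddSign as) (oddity as) ≟ᶠ fz)

admissible₅? : ∀ as → Dec (Admissible₅ as)
admissible₅? as = (oddSign as ◃ 1) *ℤ kron2 (oddity as) ≟ℤ -1ℤ

admissible₄-oddForm : ∀ A B → A + B ≡ 4 → ¬ Mixed A B → Admissible₄ (oddForm A B)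
admissible₄-oddForm = from-yes (∀-rank≡? (λ A B → ¬? (mixed? A B) →-dec admissible₄? (oddForm A B)) 4)

admissible₅-oddForm : ∀ A B → A + B ≡ 5 → ¬ Mixed A B → Admissible₅ (oddForm A B)
admissible₅-oddForm = from-yes (∀-rank≡? (λ A B → ¬? (mixed? A B) →-dec admissible₅? (oddForm A B)) 5)

admissible₄-tally : ∀ as → length as ≡ 4 → Admissible₄ as → ¬ uncurry Mixed (tally as)
admissible₄-tally = from-yes (∀-length? (λ as → admissible₄? as →-dec ¬? (uncurry mixed? (tally as))) 4)

admissible₅-tally : ∀ as → length as ≡ 5 → Admissible₅ as → ¬ uncurry Mixed (tally as)
admissible₅-tally = from-yes (∀-length? (λ as → admissible₅? as →-dec ¬? (uncurry mixed? (tally as))) 5)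

-- Classification

length-oddForm : ∀ A B → length (oddForm A B) ≡ A + B
length-oddForm A B = trans (length-++ (replicate A o1)) (cong₂ _+_ (length-replicate A) (length-replicate B))

length-oddForm-≤ : ∀ {n} A B → A + B ≤ n → length (oddForm A B) ≤ n
length-oddForm-≤ A B = ≤-trans (≤-reflexive (length-oddForm A B))

tally-rank : ∀ as → uncurry _+_ (tally as) ≡ length as
tally-rank []        = refl
tally-rank (o1 ∷ as) = cong suc (tally-rank as)
tally-rank (o5 ∷ as) = cong suc (tally-rank as)
tally-rank (o3 ∷ as) = trans (+-suc _ _) (cong suc (tally-rank as))
tally-rank (o7 ∷ as) = trans (+-suc _ _) (cong suc (tally-rank as))

replicate-⊆ : ∀ {A : Set} {m n} (x : A) → m ≤ n → replicate m x ⊆ replicate n x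
replicate-⊆ {n = n}     x z≤n       = minimum (replicate n x)
replicate-⊆             x (s≤s m≤n) = refl ∷ replicate-⊆ x m≤n

oddPart-⊆ : ∀ {a b A B cs bs} → a ≤ A → b ≤ B → cs ⊆ bs → ⟦ ⟨ [] , (a , b) , cs ⟩ ⟧ ⊆ ⟦ ⟨ [] , (A , B) , bs ⟩ ⟧
oddPart-⊆ a≤A b≤B cs⊆bs =
  ++⁺ (⊆-map⁺ odd2 (++⁺ (replicate-⊆ o1 a≤A) (replicate-⊆ o3 b≤B))) (⊆-map⁺ odd4 cs⊆bs)

split-≤ : ∀ {n} A B → n ≤ A + B → ∃₂ λ a b → a ≤ A × b ≤ B × a + b ≡ n
split-≤ {n} A B n≤A+B with ≤-total n A
... | inj₁ n≤A = n , 0 , n≤A , z≤n , +-identityʳ n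
... | inj₂ A≤n = A , n ∸ A , ≤-refl , m≤n+o⇒m∸n≤o n A n≤A+B , m+[n∸m]≡n A≤n

Classified : List Atom → Set
Classified D = HasIsotropicV4 D ⊎ Σ (List Atom) λ L → Listed L × D ≅ L

Classified-resp : ∀ {D E} → D ≅ E → Classified E → Classified D
Classified-resp i (inj₁ iso)          = inj₁ (HasIsotropicV4-mono (≅⇒↣ (≅-sym i)) iso)
Classified-resp i (inj₂ (L , l , j)) = inj₂ (L , l , ≅-trans i j)

isotropic : ∀ {D E} → D ⊆ E → HasIsotropicV4 D → Classified E
isotropic D⊆E h = inj₁ (HasIsotropicV4-mono (⊆⇒↣ D⊆E) h)

isotropic-rank : ∀ n A B bs → n ≤ A + B → (∀ a b → a + b ≡ n → HasIsotropicV4 ⟦ ⟨ [] , (a , b) , bs ⟩ ⟧) →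
  Classified ⟦ ⟨ [] , (A , B) , bs ⟩ ⟧
isotropic-rank n A B bs r h with split-≤ A B r
... | a , b , a≤A , b≤B , e = isotropic (oddPart-⊆ a≤A b≤B ⊆-refl) (h a b e)

listed : ∀ {D} → Listed D → Classified D
listed l = inj₂ (_ , l , ≅-refl)

is2t : ∀ as → Is2t (oddity as) (oddSign as) (length as) (map odd2 as)
is2t as = as , refl , refl , refl , refl

is4s : ∀ bs → Is4s (oddity bs) (oddSign bs) (length bs) (map odd4 bs)
is4s bs = bs , refl , refl , refl , refl

is2II : ∀ ps → Is2II (prodSign (map planeSign ps)) (2 * length ps) (map plane ps)
is2II ps = ps , refl , refl , refl

listed-odd : ∀ as → length as ≤ 5 → (length as ≡ 4 → Admissible₄ as) → (length as ≡ 5 → Admissible₅ as) →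
  Listed (map odd2 as ++ [])
listed-odd []                          _ _  _  = trivial
listed-odd as@(_ ∷ [])                 _ _  _  = odd≤3 _ _ _ _ (s≤s z≤n) (s≤s z≤n) (is2t as)
listed-odd as@(_ ∷ _ ∷ [])             _ _  _  = odd≤3 _ _ _ _ (s≤s z≤n) (s≤s (s≤s z≤n)) (is2t as)
listed-odd as@(_ ∷ _ ∷ _ ∷ [])         _ _  _  = odd≤3 _ _ _ _ (s≤s z≤n) ≤-refl (is2t as)
listed-odd as@(_ ∷ _ ∷ _ ∷ _ ∷ [])     _ c₄ _  = odd4dim _ _ _ (c₄ refl) (is2t as)
listed-odd as@(_ ∷ _ ∷ _ ∷ _ ∷ _ ∷ []) _ _  c₅ = odd5dim _ _ _ (c₅ refl) (is2t as)
listed-odd (_ ∷ _ ∷ _ ∷ _ ∷ _ ∷ _ ∷ _) (s≤s (s≤s (s≤s (s≤s (s≤s ()))))) _ _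

listed-odd-four : ∀ as → length as ≤ 3 → ∀ b → Listed (map odd2 as ++ map odd4 (b ∷ []))
listed-odd-four []         _ b = four1 _ _ _ (is4s (b ∷ []))
listed-odd-four as@(_ ∷ _) r b = odd≤3four1 _ _ _ _ _ _ _ (s≤s z≤n) r (is2t as) (is4s (b ∷ []))

listed-odd-four² : ∀ as → length as ≤ 1 → ∀ b c → Listed (map odd2 as ++ map odd4 (b ∷ c ∷ []))
listed-odd-four² []          _        b c = four2 _ _ _ (is4s (b ∷ c ∷ []))
listed-odd-four² as@(_ ∷ []) _        b c = odd1four2 _ _ _ _ _ _ (is2t as) (is4s (b ∷ c ∷ []))
listed-odd-four² (_ ∷ _ ∷ _) (s≤s ()) _ _

classify-odd : ∀ A B bs → Classified ⟦ ⟨ [] , (A , B) , bs ⟩ ⟧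
classify-odd A B (b ∷ c ∷ d ∷ bs) =
  isotropic (++⁺ˡ (map odd2 (oddForm A B)) (refl ∷ refl ∷ refl ∷ minimum _)) (isotropic-four³ b c d)
classify-odd A B (b ∷ c ∷ []) with A + B ≤? 1
... | yes r = listed (listed-odd-four² (oddForm A B) (length-oddForm-≤ A B r) b c)
... | no r  = isotropic-rank 2 A B _ (≰⇒> r) λ a a' e → isotropic-rank2-four² a a' e b c
classify-odd A B (b ∷ []) with A + B ≤? 3
... | yes r = listed (listed-odd-four (oddForm A B) (length-oddForm-≤ A B r) b)
... | no r  = isotropic-rank 4 A B _ (≰⇒> r) λ a a' e → isotropic-rank4-four a a' e b
classify-odd A B [] with mixed? A B | A + B ≤? 5
... | yes (2≤A , 2≤B) | _     = isotropic (oddPart-⊆ 2≤A 2≤B ⊆-refl) isotropic-odd-2-2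
... | no _            | no r  = isotropic-rank 6 A B _ (≰⇒> r) isotropic-rank6
... | no c            | yes r = listed (listed-odd (oddForm A B) (length-oddForm-≤ A B r)
  (λ e → admissible₄-oddForm A B (trans (sym (length-oddForm A B)) e) c)
  (λ e → admissible₅-oddForm A B (trans (sym (length-oddForm A B)) e) c))

classify-even : ∀ p ps bs → Classified ⟦ ⟨ p ∷ ps , (0 , 0) , bs ⟩ ⟧
classify-even p ps (b ∷ c ∷ d ∷ bs) =
  isotropic (++⁺ˡ (map plane (p ∷ ps)) (refl ∷ refl ∷ refl ∷ minimum _)) (isotropic-four³ b c d)
classify-even hypP (hypP ∷ ps)        bs = isotropic (refl ∷ refl ∷ minimum _) (isotropic-plane² hypP)
classify-even ellP (ellP ∷ ps)        bs = isotropic (refl ∷ refl ∷ minimum _) (isotropic-plane² ellP)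
classify-even hypP (ellP ∷ hypP ∷ ps) bs = isotropic (refl ∷ _ ∷ʳ refl ∷ minimum _) (isotropic-plane² hypP)
classify-even hypP (ellP ∷ ellP ∷ ps) bs = isotropic (_ ∷ʳ refl ∷ refl ∷ minimum _) (isotropic-plane² ellP)
classify-even ellP (hypP ∷ hypP ∷ ps) bs = isotropic (_ ∷ʳ refl ∷ refl ∷ minimum _) (isotropic-plane² hypP)
classify-even ellP (hypP ∷ ellP ∷ ps) bs = isotropic (refl ∷ _ ∷ʳ refl ∷ minimum _) (isotropic-plane² ellP)
classify-even p (q ∷ []) (b ∷ bs)     = isotropic (refl ∷ refl ∷ refl ∷ minimum _) (isotropic-plane-plane-four p q b)
classify-even p [] (b ∷ c ∷ bs)       = isotropic (refl ∷ refl ∷ refl ∷ minimum _) (isotropic-plane-four² p b c)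
classify-even p [] []                 = listed (ii2 _ _ (is2II (p ∷ [])))
classify-even p [] (b ∷ [])           = listed (ii2four1 _ _ _ _ _ (is2II (p ∷ [])) (is4s (b ∷ [])))
classify-even hypP (ellP ∷ []) []     = listed (ii4minus _ (is2II (hypP ∷ ellP ∷ [])))
classify-even ellP (hypP ∷ []) []     = listed (ii4minus _ (is2II (ellP ∷ hypP ∷ [])))

absorb-step : ∀ {p a b c d} → (plane p ∷ odd2 a ∷ []) ≅ (odd2 b ∷ odd2 c ∷ odd2 d ∷ []) → ∀ P →
  (plane p ∷ ⟦ insert (odd2 a) P ⟧) ≅ ⟦ insert (odd2 b) (insert (odd2 c) (insert (odd2 d) P)) ⟧
absorb-step {p} {a} {b} {c} {d} i P = begin
  plane p ∷ ⟦ insert (odd2 a) P ⟧   ≈⟨ ≅-∷ (plane p) (≅-sym (≅-insert (odd2 a) P)) ⟩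
  plane p ∷ odd2 a ∷ ⟦ P ⟧          ≈⟨ ≅-++ʳ i ⟦ P ⟧ ⟩
  odd2 b ∷ odd2 c ∷ odd2 d ∷ ⟦ P ⟧  ≈⟨ ≅-∷ (odd2 b) (≅-∷ (odd2 c) (≅-insert (odd2 d) P)) ⟩
  odd2 b ∷ odd2 c ∷ ⟦ P₁ ⟧          ≈⟨ ≅-∷ (odd2 b) (≅-insert (odd2 c) P₁) ⟩
  odd2 b ∷ ⟦ P₂ ⟧                   ≈⟨ ≅-insert (odd2 b) P₂ ⟩
  ⟦ insert (odd2 b) P₂ ⟧            ∎
  where
  open ≅-Reasoning
  P₁ = insert (odd2 d) P
  P₂ = insert (odd2 c) P₁

classify-parts : ∀ ps A B bs → Classified ⟦ ⟨ ps , (A , B) , bs ⟩ ⟧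
classify-parts (hypP ∷ ps) (suc A) B bs =
  Classified-resp (absorb-step hyp⊕2₁ ⟨ ps , (A , B) , bs ⟩) (classify-parts ps (2 + A) (1 + B) bs)
classify-parts (ellP ∷ ps) (suc A) B bs =
  Classified-resp (absorb-step ell⊕2₁ ⟨ ps , (A , B) , bs ⟩) (classify-parts ps A (3 + B) bs)
classify-parts (hypP ∷ ps) 0 (suc B) bs =
  Classified-resp (absorb-step hyp⊕2₃ ⟨ ps , (0 , B) , bs ⟩) (classify-parts ps 1 (2 + B) bs)
classify-parts (ellP ∷ ps) 0 (suc B) bs =
  Classified-resp (absorb-step ell⊕2₃ ⟨ ps , (0 , B) , bs ⟩) (classify-parts ps 3 B bs)
classify-parts (p ∷ ps) 0 0 bs = classify-even p ps bs
classify-parts []       A B bs = classify-odd A B bs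

classify : ∀ D → Classified D
classify D = Classified-resp (≅-decompose D) (classify-parts planes (proj₁ odds) (proj₂ odds) fours)
  where open Parts (decompose D)

-- Anisotropy of the listed forms

tally-≤ : ∀ as {n} → length as ≤ n → uncurry _+_ (tally as) ≤ n
tally-≤ as = ≤-trans (≤-reflexive (tally-rank as))

anisotropic-tally : ∀ as bs → ¬ HasIsotropicV4 ⟦ ⟨ [] , tally as , bs ⟩ ⟧ →
  ¬ HasIsotropicV4 (map odd2 as ++ map odd4 bs)
anisotropic-tally as bs h = h ∘ HasIsotropicV4-mono (≅⇒↣ (≅-tally as bs))

anisotropic-odd2 : ∀ as → length as ≤ 5 → ¬ uncurry Mixed (tally as) → ¬ HasIsotropicV4 (map odd2 as)
anisotropic-odd2 as r c =
  anisotropic-tally as [] (anisotropic-odd (proj₁ (tally as)) (proj₂ (tally as)) (tally-≤ as r) c)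
  ∘ subst HasIsotropicV4 (sym (++-identityʳ _))

anisotropic-odd2-four : ∀ as → length as ≤ 3 → ∀ b → ¬ HasIsotropicV4 (map odd2 as ++ map odd4 (b ∷ []))
anisotropic-odd2-four as r b =
  anisotropic-tally as _ (anisotropic-odd-four (proj₁ (tally as)) (proj₂ (tally as)) (tally-≤ as r) b)

anisotropic-odd2-four² : ∀ as → length as ≤ 1 → ∀ b c → ¬ HasIsotropicV4 (map odd2 as ++ map odd4 (b ∷ c ∷ []))
anisotropic-odd2-four² as r b c =
  anisotropic-tally as _ (anisotropic-odd-four² (proj₁ (tally as)) (proj₂ (tally as)) (tally-≤ as r) b c)

rank≤3⇒¬Mixed : ∀ {A B} → A + B ≤ 3 → ¬ Mixed A B
rank≤3⇒¬Mixed r (2≤A , 2≤B) with ≤-trans (+-mono-≤ 2≤A 2≤B) r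
... | s≤s (s≤s (s≤s ()))

length≡1 : ∀ {A : Set} (xs : List A) → length xs ≡ 1 → ∃ λ x → xs ≡ x ∷ []
length≡1 (x ∷ []) refl = x , refl

length≡2 : ∀ {A : Set} (xs : List A) → length xs ≡ 2 → ∃₂ λ x y → xs ≡ x ∷ y ∷ []
length≡2 (x ∷ y ∷ []) refl = x , y , refl

listed⇒anisotropic : ∀ {L} → Listed L → ¬ HasIsotropicV4 L
listed⇒anisotropic trivial = anisotropic-odd2 [] z≤n λ ()
listed⇒anisotropic (ii2 _ _ (ps , e , _ , refl)) with length≡1 ps (*-cancelˡ-≡ _ 1 2 e)
... | p , refl = anisotropic-plane p
listed⇒anisotropic (ii4minus _ (ps , e , sg , refl)) with length≡2 ps (*-cancelˡ-≡ _ 2 2 e)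
... | p , q , refl = anisotropic-2II⁻⁴ p q sg
listed⇒anisotropic (odd≤3 _ _ _ _ _ r (as , refl , _ , _ , refl)) =
  anisotropic-odd2 as (≤-trans r (m≤m+n 3 2)) (rank≤3⇒¬Mixed (tally-≤ as r))
listed⇒anisotropic (odd4dim _ _ _ c (as , e , refl , refl , refl)) =
  anisotropic-odd2 as (≤-trans (≤-reflexive e) (n≤1+n 4)) (admissible₄-tally as e c)
listed⇒anisotropic (odd5dim _ _ _ c (as , e , refl , refl , refl)) =
  anisotropic-odd2 as (≤-reflexive e) (admissible₅-tally as e c)
listed⇒anisotropic (four1 _ _ _ (bs , e , _ , _ , refl)) with length≡1 bs e
... | b , refl = anisotropic-odd2-four [] z≤n b
listed⇒anisotropic (four2 _ _ _ (bs , e , _ , _ , refl)) with length≡2 bs e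
... | b , c , refl = anisotropic-odd2-four² [] z≤n b c
listed⇒anisotropic (ii2four1 _ _ _ _ _ (ps , e , _ , refl) (bs , e' , _ , _ , refl))
  with length≡1 ps (*-cancelˡ-≡ _ 1 2 e) | length≡1 bs e'
... | p , refl | b , refl = anisotropic-plane-four p b
listed⇒anisotropic (odd≤3four1 _ _ _ _ _ _ _ _ r (as , refl , _ , _ , refl) (bs , e , _ , _ , refl))
  with length≡1 bs e
... | b , refl = anisotropic-odd2-four as r b
listed⇒anisotropic (odd1four2 _ _ _ _ _ _ (as , e , _ , _ , refl) (bs , e' , _ , _ , refl))
  with length≡2 bs e'
... | b , c , refl = anisotropic-odd2-four² as (≤-reflexive e) b c

mainTheorem18 : (D : List Atom) →
    (¬ HasIsotropicV4 D) ⇔ (Σ (List Atom) λ L → Listed L × (D ≅ L))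
mainTheorem18 D = mk⇔ listed-if-anisotropic anisotropic-if-listed
  where
  listed-if-anisotropic : ¬ HasIsotropicV4 D → Σ (List Atom) λ L → Listed L × (D ≅ L)
  listed-if-anisotropic aniso with classify D
  ... | inj₁ iso = ⊥-elim (aniso iso)
  ... | inj₂ L    = L

  anisotropic-if-listed : (Σ (List Atom) λ L → Listed L × (D ≅ L)) → ¬ HasIsotropicV4 D
  anisotropic-if-listed (L , l , D≅L) = listed⇒anisotropic l ∘ HasIsotropicV4-mono (≅⇒↣ D≅L)
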